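{- $\mathcal{TC}(\mathrm{RL}_1^P)\subsetneq\mathcal{TC}(\mathrm{RL}_2^P)$.
   Context: A right-linear grammar is $G=(N,T,P,S)$ with rules of the form $A\to wB$ or $A\to w$, $A,B\in N$, $w\in T^*$. $\mathrm{RL}_n^P$ is the family of regular languages generated by some right-linear grammar with at most $n$ production rules. A tree-controlled grammar is a quintuple $G=(N,T,P,S,R)$ where $(N,T,P,S)$ is a context-free grammar whose rules are all non-erasing (the only exception being that $S\to\lambda$ is allowed if $S$ does not occur on the right-hand side of any rule), and $R$ is a regular language over $N\cup T$. For a derivation tree, the word of level $j$ is the word formed by all nodes of depth $j$ read from left to right. $L(G)$ consists of all $z\in T^*$ having a derivation tree $t$ whose leaves read left to right give $z$ and such that the words of all levels of $t$, except the last one, belong to $R$. For a family $\mathcal{F}$ of regular languages, $\mathcal{TC}(\mathcal{F})$ is the family of languages $L(G)$ of tree-controlled grammars with $R\in\mathcal{F}$. -}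

module Defs where

open import Data.Nat using (ℕ; zero; suc; _≤_; _<_; _⊔_)
open import Data.Fin using (Fin)
open import Data.List using (List; []; _∷_; _++_; length)
open import Data.List.Membership.Propositional using (_∈_)
open import Data.List.Relation.Unary.All using (All)
open import Data.Maybe using (Maybe; just; nothing)
open import Data.Product using (Σ; _×_; _,_; proj₁; proj₂; ∃)
open import Data.Sum using (_⊎_; inj₁; inj₂)
open import Relation.Binary.PropositionalEquality using (_≡_)
open import Relation.Nullary using (¬_)
open import Data.Unit using (⊤)
open import Function.Bundles using (_⇔_)

Language : Set → Set₁
Language X = List X → Set

-- A rule  A → w B  (third component  just B)  or  A → w  (nothing).
RLRule : ℕ → Set → Set
RLRule m X = Fin m × List X × Maybe (Fin m)

record RLGrammar (X : Set) : Set where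
  field
    nNT   : ℕ
    rules : List (RLRule nNT X)
    start : Fin nNT

module _ {X : Set} (G : RLGrammar X) where
  open RLGrammar G
  data RLDerives : Fin nNT → List X → Set where
    stop : ∀ {A w} → (A , w , nothing) ∈ rules → RLDerives A w
    step : ∀ {A B w v} → (A , w , just B) ∈ rules → RLDerives B v →
           RLDerives A (w ++ v)

RLLang : {X : Set} → RLGrammar X → Language X
RLLang G = RLDerives G (RLGrammar.start G)

InRLP : (n : ℕ) → {X : Set} → Language X → Set
InRLP n {X} L = Σ (RLGrammar X) λ G →
  (length (RLGrammar.rules G) ≤ n) × (∀ w → L w ⇔ RLLang G w)

Sym : ℕ → ℕ → Set
Sym k t = Fin k ⊎ Fin t

CFRule : ℕ → ℕ → Set
CFRule k t = Fin k × List (Sym k t)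

record TCGrammar (t : ℕ) : Set₁ where
  field
    nNT     : ℕ
    rules   : List (CFRule nNT t)
    start   : Fin nNT
    control : Language (Sym nNT t)
    nonErasing : All (λ r → proj₂ r ≡ [] →
                   (proj₁ r ≡ start) ×
                   All (λ r' → ¬ (inj₁ start ∈ proj₂ r')) rules) rules

-- Derivation trees.  A node with an empty list of children stands for a
-- node with a single λ-leaf child (application of S → λ).
data Tree (k t : ℕ) : Set where
  leaf : Fin t → Tree k t
  node : Fin k → List (Tree k t) → Tree k t

module _ {k t : ℕ} where

  root : Tree k t → Sym k t
  root (leaf a)   = inj₂ a
  root (node A _) = inj₁ A

  roots : List (Tree k t) → List (Sym k t)
  roots []       = []
  roots (x ∷ xs) = root x ∷ roots xs

  mutual
    yield : Tree k t → List (Fin t)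
    yield (leaf a)    = a ∷ []
    yield (node _ cs) = yields cs

    yields : List (Tree k t) → List (Fin t)
    yields []       = []
    yields (c ∷ cs) = yield c ++ yields cs

  mutual
    -- word of level j (λ-leaves contribute the empty word)
    level : ℕ → Tree k t → List (Sym k t)
    level zero    x           = root x ∷ []
    level (suc j) (leaf _)    = []
    level (suc j) (node _ cs) = levels j cs

    levels : ℕ → List (Tree k t) → List (Sym k t)
    levels j []       = []
    levels j (c ∷ cs) = level j c ++ levels j cs

  mutual
    -- depth of the last level (a λ-leaf sits at depth 1 below its parent)
    height : Tree k t → ℕ
    height (leaf _)           = zero
    height (node _ [])        = suc zero
    height (node _ (c ∷ cs))  = suc (heights (c ∷ cs))

    heights : List (Tree k t) → ℕ
    heights []       = zero
    heights (c ∷ cs) = height c ⊔ heights cs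

  mutual
    ValidTree : List (CFRule k t) → Tree k t → Set
    ValidTree P (leaf _)    = ⊤
    ValidTree P (node A cs) = ((A , roots cs) ∈ P) × ValidTrees P cs

    ValidTrees : List (CFRule k t) → List (Tree k t) → Set
    ValidTrees P []       = ⊤
    ValidTrees P (c ∷ cs) = ValidTree P c × ValidTrees P cs

TCLang : {t : ℕ} → TCGrammar t → Language (Fin t)
TCLang {t} G z = Σ (Tree nNT t) λ tr →
    ValidTree rules tr × (root tr ≡ inj₁ start) × (yield tr ≡ z) ×
    (∀ j → j < height tr → control (level j tr))
  where open TCGrammar G

InTCRL : (n t : ℕ) → Language (Fin t) → Set₁
InTCRL n t L = Σ (TCGrammar t) λ G →
  InRLP n (TCGrammar.control G) × (∀ z → L z ⇔ TCLang G z)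

-- A right-linear grammar with a single rule generates at most one word, so a
-- control language in RL₁ᴾ that admits any derivation at all is exactly {S}.
-- Every non-final level of a derivation tree is then the word S: the tree is
-- a chain of steps S → S ending in one rule S → α whose children are leaves,
-- and its yield is no longer than the longest right-hand side.  Hence
-- TC(RL₁ᴾ) contains only finite languages, whereas the control language a*S,
-- which needs two rules, lets S → aS | a generate the infinite language a⁺.
module Submission where

open import Defs
open import Data.Nat using (ℕ; zero; suc; _≤_; _<_; _+_; z≤n; s≤s)
open import Data.Nat.Properties
  using (≤-trans; m≤m+n; m≤n+m; m≤m⊔n; ⊔-identityʳ; n≢0⇒n>0; _≟_; 1+n≰n)
open import Data.Fin using (Fin; zero)
open import Data.List using (List; []; _∷_; _++_; length)
open import Data.List.Properties using (++-identityʳ)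
open import Data.List.Membership.Propositional using (_∈_)
open import Data.List.Relation.Unary.Any using (here; there)
open import Data.List.Relation.Unary.All using ([]; _∷_)
open import Data.Maybe using (just; nothing)
open import Data.Product using (Σ; _×_; _,_; proj₁; proj₂; ∃)
open import Data.Sum using (inj₁; inj₂)
open import Data.Unit using (tt)
open import Relation.Binary.PropositionalEquality
  using (_≡_; _≢_; refl; sym; trans; cong; subst)
open import Relation.Nullary using (¬_; yes; no; contradiction)
open import Function.Bundles using (mk⇔; Equivalence)

InTCRL1⇒InTCRL2 : ∀ t (L : Language (Fin t)) → InTCRL 1 t L → InTCRL 2 t L
InTCRL1⇒InTCRL2 t L (G , (H , |H|≤1 , L⇔H) , L⇔G) =
  G , (H , ≤-trans |H|≤1 (s≤s z≤n) , L⇔H) , L⇔G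

∈-length≤1-unique : ∀ {A : Set} {xs : List A} {x y : A} →
                    length xs ≤ 1 → x ∈ xs → y ∈ xs → x ≡ y
∈-length≤1-unique {xs = _ ∷ []}    _ (here refl) (here refl) = refl
∈-length≤1-unique {xs = _ ∷ _ ∷ _} (s≤s ()) _ _

module _ {X : Set} (G : RLGrammar X) where
  open RLGrammar G

  terminatingRule : ∀ {A u} → RLDerives G A u →
                    ∃ λ B → ∃ λ w → (B , w , nothing) ∈ rules
  terminatingRule (stop r)   = _ , _ , r
  terminatingRule (step _ d) = terminatingRule d

  RLDerives-unique : length rules ≤ 1 → ∀ {A B u v} →
                     RLDerives G A u → RLDerives G B v → u ≡ v
  RLDerives-unique |P|≤1 (stop r) (stop r′) =
    cong (λ (rule : RLRule nNT X) → proj₁ (proj₂ rule)) (∈-length≤1-unique |P|≤1 r r′)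
  RLDerives-unique |P|≤1 (step r _) d′ with terminatingRule d′
  ... | _ , _ , r′ with ∈-length≤1-unique |P|≤1 r r′
  ... | ()
  RLDerives-unique |P|≤1 (stop r) (step r′ _) with ∈-length≤1-unique |P|≤1 r r′
  ... | ()

InRLP1⇒unique : ∀ {X} {L : Language X} → InRLP 1 L → ∀ {u v} → L u → L v → u ≡ v
InRLP1⇒unique (G , |P|≤1 , L⇔G) Lu Lv =
  RLDerives-unique G |P|≤1 (Equivalence.to (L⇔G _) Lu) (Equivalence.to (L⇔G _) Lv)

rhsLengthSum : ∀ {k t} → List (CFRule k t) → ℕ
rhsLengthSum []       = 0
rhsLengthSum (r ∷ rs) = length (proj₂ r) + rhsLengthSum rs

∈⇒rhsLength≤rhsLengthSum : ∀ {k t} {r : CFRule k t} {rs} →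
                           r ∈ rs → length (proj₂ r) ≤ rhsLengthSum rs
∈⇒rhsLength≤rhsLengthSum (here refl) = m≤m+n _ _
∈⇒rhsLength≤rhsLengthSum (there r∈rs) = ≤-trans (∈⇒rhsLength≤rhsLengthSum r∈rs) (m≤n+m _ _)

module _ {k t : ℕ} where

  LevelsSingleton : Fin k → Tree k t → Set
  LevelsSingleton S tr = ∀ j → j < height tr → level j tr ≡ inj₁ S ∷ []

  height-node≥1 : ∀ (A : Fin k) cs → 1 ≤ height {k} {t} (node A cs)
  height-node≥1 A []      = s≤s z≤n
  height-node≥1 A (_ ∷ _) = s≤s z≤n

  length-yields-flat : (cs : List (Tree k t)) → heights cs ≡ 0 →
                       length (yields cs) ≡ length (roots cs)
  length-yields-flat []               _ = refl
  length-yields-flat (leaf _ ∷ cs)    h = cong suc (length-yields-flat cs h)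
  length-yields-flat (node A ds ∷ cs) h
    with subst (1 ≤_) h (≤-trans (height-node≥1 A ds) (m≤m⊔n _ (heights cs)))
  ... | ()

  height-node>1 : ∀ (A : Fin k) cs → heights {k} {t} cs ≢ 0 → 1 < height (node A cs)
  height-node>1 A []      deep = contradiction refl deep
  height-node>1 A (_ ∷ _) deep = s≤s (n≢0⇒n>0 deep)

  LevelsSingleton-child : ∀ {S} ds →
    LevelsSingleton S (node S (node S ds ∷ [])) → LevelsSingleton S (node S ds)
  LevelsSingleton-child ds h j j<h =
    trans (sym (++-identityʳ _)) (h (suc j) (s≤s (≤-trans j<h (m≤m⊔n _ 0))))

  -- Level 1 is the list of roots of the children: a non-flat tree must have
  -- the single child S there, so it is a one-step extension of a smaller tree.
  length-yields≤rhsLengthSum : ∀ (P : List (CFRule k t)) {S} cs →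
    ValidTree P (node S cs) → LevelsSingleton S (node S cs) →
    length (yields cs) ≤ rhsLengthSum P
  length-yields≤rhsLengthSum P {S} cs (r , _) h with heights cs ≟ 0
  ... | yes flat =
    subst (_≤ rhsLengthSum P) (sym (length-yields-flat cs flat))
          (∈⇒rhsLength≤rhsLengthSum r)
  ... | no deep with h 1 (height-node>1 S cs deep)
  length-yields≤rhsLengthSum P (node S ds ∷ []) (_ , v , _) h | no _ | refl
    rewrite ++-identityʳ (yields ds) =
    length-yields≤rhsLengthSum P ds v (LevelsSingleton-child ds h)
  length-yields≤rhsLengthSum P (leaf _ ∷ _)       _ _ | no _ | ()
  length-yields≤rhsLengthSum P (node _ _ ∷ _ ∷ _) _ _ | no _ | ()

LengthBounded : ∀ {X} → Language X → Set
LengthBounded L = ∃ λ M → ∀ z → L z → length z ≤ M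

InTCRL1⇒LengthBounded : ∀ {t} {L : Language (Fin t)} → InTCRL 1 t L → LengthBounded L
InTCRL1⇒LengthBounded {L = L} (G , R∈RL₁ , L⇔G) = rhsLengthSum rules , bound
  where
  open TCGrammar G
  bound : ∀ z → L z → length z ≤ rhsLengthSum rules
  bound z Lz with Equivalence.to (L⇔G z) Lz
  ... | node S cs , valid , refl , refl , controlled =
    length-yields≤rhsLengthSum rules cs valid λ j j<h →
      InRLP1⇒unique R∈RL₁ (controlled j j<h) (controlled 0 (height-node≥1 S cs))

a : Fin 1
a = zero

S : Fin 1
S = zero

a*S : RLGrammar (Sym 1 1)
a*S = record
  { nNT   = 1
  ; rules = (S , inj₂ a ∷ [] , just S) ∷ (S , inj₁ S ∷ [] , nothing) ∷ []
  ; start = S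
  }

a⁺-grammar : TCGrammar 1
a⁺-grammar = record
  { nNT        = 1
  ; rules      = (S , inj₂ a ∷ inj₁ S ∷ []) ∷ (S , inj₂ a ∷ []) ∷ []
  ; start      = S
  ; control    = RLLang a*S
  ; nonErasing = (λ ()) ∷ (λ ()) ∷ []
  }

a⁺ : Language (Fin 1)
a⁺ = TCLang a⁺-grammar

a⁺∈TC-RL₂ : InTCRL 2 1 a⁺
a⁺∈TC-RL₂ = a⁺-grammar , (a*S , s≤s (s≤s z≤n) , λ _ → mk⇔ (λ w → w) (λ w → w))
          , λ _ → mk⇔ (λ z → z) (λ z → z)

a⁺-tree : ℕ → Tree 1 1
a⁺-tree zero    = node S (leaf a ∷ [])
a⁺-tree (suc n) = node S (leaf a ∷ a⁺-tree n ∷ [])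

root-a⁺-tree : ∀ n → root (a⁺-tree n) ≡ inj₁ S
root-a⁺-tree zero    = refl
root-a⁺-tree (suc n) = refl

valid-a⁺-tree : ∀ n → ValidTree (TCGrammar.rules a⁺-grammar) (a⁺-tree n)
valid-a⁺-tree zero    = there (here refl) , tt , tt
valid-a⁺-tree (suc n) =
  here (cong (λ X → S , inj₂ a ∷ X ∷ []) (root-a⁺-tree n)) , tt , valid-a⁺-tree n , tt

length-yield-a⁺-tree : ∀ n → length (yield (a⁺-tree n)) ≡ suc n
length-yield-a⁺-tree zero    = refl
length-yield-a⁺-tree (suc n) =
  cong suc (trans (cong length (++-identityʳ (yield (a⁺-tree n)))) (length-yield-a⁺-tree n))

a*S-S : RLLang a*S (inj₁ S ∷ [])
a*S-S = stop (there (here refl))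

controlled-a⁺-tree : ∀ n j → j < height (a⁺-tree n) → RLLang a*S (level j (a⁺-tree n))
controlled-a⁺-tree n zero _ =
  subst (λ X → RLLang a*S (X ∷ [])) (sym (root-a⁺-tree n)) a*S-S
controlled-a⁺-tree zero (suc j) (s≤s ())
controlled-a⁺-tree (suc n) (suc zero) _ =
  subst (λ X → RLLang a*S (inj₂ a ∷ X ∷ [])) (sym (root-a⁺-tree n)) (step (here refl) a*S-S)
controlled-a⁺-tree (suc n) (suc (suc j)) (s≤s j<h) =
  subst (RLLang a*S) (sym (++-identityʳ _))
        (controlled-a⁺-tree n (suc j) (subst (suc (suc j) ≤_) (⊔-identityʳ _) j<h))

yield-a⁺-tree∈a⁺ : ∀ n → a⁺ (yield (a⁺-tree n))
yield-a⁺-tree∈a⁺ n = a⁺-tree n , valid-a⁺-tree n , root-a⁺-tree n , refl , controlled-a⁺-tree n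

a⁺-unbounded : ¬ LengthBounded a⁺
a⁺-unbounded (M , bound) =
  1+n≰n (subst (_≤ M) (length-yield-a⁺-tree M) (bound _ (yield-a⁺-tree∈a⁺ M)))

theorem27 : ((t : ℕ) → (L : Language (Fin t)) → InTCRL 1 t L → InTCRL 2 t L)
    × Σ ℕ (λ t → Σ (Language (Fin t)) (λ L → InTCRL 2 t L × ¬ InTCRL 1 t L))
theorem27 =
  InTCRL1⇒InTCRL2 , 1 , a⁺ , a⁺∈TC-RL₂ , λ a⁺∈TC-RL₁ → a⁺-unbounded (InTCRL1⇒LengthBounded a⁺∈TC-RL₁)
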